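{- (1) Let $\mathbb{A}$ be an SBM algebra. The equivalence relation $\theta_{\mathbb{A}}$ whose blocks are $\max(\mathbb{A})$ and the singletons $\{a\}$, $a\notin\max(\mathbb{A})$, is a congruence of $\mathbb{A}$. (2) Let $R$ be a subdirect product of SBM algebras $\mathbb{A}_1,\dots,\mathbb{A}_n$, and let $\max(R)=R\cap(\max(\mathbb{A}_1)\times\dots\times\max(\mathbb{A}_n))$. The equivalence relation $\theta_R$ on $R$ whose blocks are $\max(R)$ and the singletons $\{\mathbf{a}\}$, $\mathbf{a}\in R\setminus\max(R)$, is a congruence of $R$.
   Context: SBM algebras (paper's convention): an SBM algebra is a finite idempotent algebra $\mathbb{A}=(A;\cdot,m)$ with exactly two basic operations, a binary $\cdot$ (juxtaposition) and a ternary $m$, together with a congruence $\sigma_{\mathbb{A}}$ such that $\mathbb{A}/\sigma_{\mathbb{A}}$ is term equivalent to a semilattice with semilattice operation induced by $\cdot$; on every $\sigma_{\mathbb{A}}$-block $B$, $xy=x$ for $x,y\in B$ and $m$ is Mal'tsev ($m(x,y,y)=m(y,y,x)=x$); moreover $x(xy)=xy$ for all $x,y$ and $m(a,b,c)$ is $\sigma_{\mathbb{A}}$-related to $(ab)c$ for all $a,b,c$. $\max(\mathbb{A})$ is the $\sigma_{\mathbb{A}}$-block that is the greatest element of the semilattice $\mathbb{A}/\sigma_{\mathbb{A}}$ (order $u\le v$ iff $uv=v$), i.e. the block $M$ with $M\cdot a\subseteq M$ for all $a$. A subdirect product of $\mathbb{A}_1,\dots,\mathbb{A}_n$ is a subalgebra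 $R$ of $\mathbb{A}_1\times\dots\times\mathbb{A}_n$ (operations coordinatewise) whose projection onto each coordinate $i$ is $A_i$. -}

module Defs where

open import Data.Nat using (ℕ)
open import Data.Fin using (Fin)
open import Data.List using (List)
open import Data.List.Membership.Propositional using (_∈_)
open import Data.Product using (Σ; ∃; _×_; _,_; proj₁; proj₂)
open import Data.Sum using (_⊎_)
open import Relation.Binary using (Rel; IsEquivalence)
open import Relation.Binary.PropositionalEquality using (_≡_)

record Alg : Set₁ where
  field
    Carrier : Set
    _·_     : Carrier → Carrier → Carrier
    m       : Carrier → Carrier → Carrier → Carrier

-- A congruence of an algebra with respect to a given equality _≈_ on the carrier
-- (for a plain algebra _≈_ is _≡_; for subalgebras of products it is pointwise _≡_).
record IsCongruence (𝔸 : Alg) (_≈_ : Rel (Alg.Carrier 𝔸) _) (θ : Rel (Alg.Carrier 𝔸) _) : Set where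
  open Alg 𝔸
  field
    isEquivalence : IsEquivalence θ
    respects-≈    : ∀ {a a' b b'} → a ≈ a' → b ≈ b' → θ a b → θ a' b'
    ·-compat      : ∀ {a a' b b'} → θ a a' → θ b b' → θ (a · b) (a' · b')
    m-compat      : ∀ {a a' b b' c c'} → θ a a' → θ b b' → θ c c' →
                    θ (m a b c) (m a' b' c')

IsCong : (𝔸 : Alg) → Rel (Alg.Carrier 𝔸) _ → Set
IsCong 𝔸 θ = IsCongruence 𝔸 _≡_ θ

-- The condition "A/σ is term equivalent to a semilattice whose
-- semilattice operation is induced by ·" is unfolded as: · is a semilattice
-- operation modulo σ (idempotent, commutative, associative), and m is a term
-- operation of · modulo σ, namely m(a,b,c) σ (ab)c (which the paper states anyway).
record SBM : Set₁ where
  field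
    alg : Alg
  open Alg alg public
  field
    elements  : List Carrier
    complete  : ∀ x → x ∈ elements
    ·-idem    : ∀ x → x · x ≡ x
    m-idem    : ∀ x → m x x x ≡ x
    σ         : Rel Carrier _
    σ-cong    : IsCong alg σ
    σ-comm    : ∀ x y → σ (x · y) (y · x)
    σ-assoc   : ∀ x y z → σ ((x · y) · z) (x · (y · z))
    block-left : ∀ {x y} → σ x y → x · y ≡ x
    block-m₁   : ∀ {x y} → σ x y → m x y y ≡ x
    block-m₂   : ∀ {x y} → σ x y → m y y x ≡ x
    absorb    : ∀ x y → x · (x · y) ≡ x · y
    m-σ       : ∀ a b c → σ (m a b c) ((a · b) · c)

  -- a ∈ max(A): the σ-block of a is the top of A/σ, i.e. a·b σ a for all b
  -- (equivalently, b ≤ [a] for all b, where u ≤ v iff uv = v in A/σ).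
  InMax : Carrier → Set
  InMax a = ∀ b → σ (a · b) a

  θ : Rel Carrier _
  θ a b = (InMax a × InMax b) ⊎ a ≡ b

module _ {n : ℕ} (𝔸 : Fin n → SBM) where
  open SBM

  Π : Set
  Π = (i : Fin n) → Carrier (𝔸 i)

  _·Π_ : Π → Π → Π
  (x ·Π y) i = _·_ (𝔸 i) (x i) (y i)

  mΠ : Π → Π → Π → Π
  mΠ x y z i = m (𝔸 i) (x i) (y i) (z i)

  record IsSubdirect (R : Π → Set) : Set where
    field
      ·-closed  : ∀ {x y} → R x → R y → R (x ·Π y)
      m-closed  : ∀ {x y z} → R x → R y → R z → R (mΠ x y z)
      surjective : ∀ i (a : Carrier (𝔸 i)) → ∃ λ x → R x × x i ≡ a

  subAlg : (R : Π → Set) → IsSubdirect R → Alg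
  subAlg R S = record
    { Carrier = Σ Π R
    ; _·_ = λ x y → (proj₁ x ·Π proj₁ y) , IsSubdirect.·-closed S (proj₂ x) (proj₂ y)
    ; m = λ x y z → mΠ (proj₁ x) (proj₁ y) (proj₁ z) ,
                    IsSubdirect.m-closed S (proj₂ x) (proj₂ y) (proj₂ z)
    }

  _≈R_ : {R : Π → Set} → Rel (Σ Π R) _
  x ≈R y = ∀ i → proj₁ x i ≡ proj₁ y i

  InMaxR : {R : Π → Set} → Σ Π R → Set
  InMaxR x = ∀ i → InMax (𝔸 i) (proj₁ x i)

  θR : {R : Π → Set} → Rel (Σ Π R) _
  θR x y = (InMaxR x × InMaxR y) ⊎ x ≈R y

-- Collapsing an absorbing subset (one containing every operation value that has an
-- argument in it) to a single block always gives a congruence, as for Rees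
-- congruences of semigroup ideals.  max(𝔸) is absorbing: it is a union of σ-blocks,
-- a·b lies in the top σ-block as soon as a or b does because 𝔸/σ is a semilattice,
-- and m(a,b,c) σ (ab)c.  max(R) is then absorbing in R coordinatewise.
module Submission where

open import Defs
open import Data.Nat using (ℕ)
open import Data.Fin using (Fin)
open import Data.Product using (_×_; _,_; proj₁)
open import Data.Sum using (_⊎_; inj₁; inj₂)
open import Level using (0ℓ)
open import Relation.Binary using (Rel; IsEquivalence; Setoid; _Respects_)
open import Relation.Binary.PropositionalEquality as ≡ using (_≡_; refl; cong₂)

record IsAbsorbing (𝔸 : Alg) (M : Alg.Carrier 𝔸 → Set) : Set where
  open Alg 𝔸
  field
    ·-absorbˡ : ∀ a b → M a → M (a · b)
    ·-absorbʳ : ∀ a b → M b → M (a · b)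
    m-absorb₁ : ∀ a b c → M a → M (m a b c)
    m-absorb₂ : ∀ a b c → M b → M (m a b c)
    m-absorb₃ : ∀ a b c → M c → M (m a b c)

module Rees (𝔸 : Alg) {_≈_ : Rel (Alg.Carrier 𝔸) 0ℓ} (≈-cong : IsCongruence 𝔸 _≈_ _≈_)
            {M : Alg.Carrier 𝔸 → Set} (M-absorbing : IsAbsorbing 𝔸 M) (M-resp : M Respects _≈_)
            where
  open Alg 𝔸
  open IsCongruence ≈-cong using (·-compat; m-compat)
  open IsEquivalence (IsCongruence.isEquivalence ≈-cong) renaming (refl to ≈-refl; sym to ≈-sym; trans to ≈-trans)
  open IsAbsorbing M-absorbing

  reesRel : Rel Carrier 0ℓ
  reesRel a b = (M a × M b) ⊎ a ≈ b

  reesRel-isEquivalence : IsEquivalence reesRel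
  reesRel-isEquivalence = record { refl = inj₂ ≈-refl ; sym = symmetric ; trans = transitive }
    where
    symmetric : ∀ {a b} → reesRel a b → reesRel b a
    symmetric (inj₁ (ma , mb)) = inj₁ (mb , ma)
    symmetric (inj₂ a≈b)       = inj₂ (≈-sym a≈b)

    transitive : ∀ {a b c} → reesRel a b → reesRel b c → reesRel a c
    transitive (inj₁ (ma , _))  (inj₁ (_ , mc))  = inj₁ (ma , mc)
    transitive (inj₁ (ma , mb)) (inj₂ b≈c)       = inj₁ (ma , M-resp b≈c mb)
    transitive (inj₂ a≈b)       (inj₁ (mb , mc)) = inj₁ (M-resp (≈-sym a≈b) mb , mc)
    transitive (inj₂ a≈b)       (inj₂ b≈c)       = inj₂ (≈-trans a≈b b≈c)

  reesRel-isCongruence : IsCongruence 𝔸 _≈_ reesRel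
  reesRel-isCongruence = record
    { isEquivalence = reesRel-isEquivalence
    ; respects-≈    = respects
    ; ·-compat      = ·-compatible
    ; m-compat      = m-compatible
    }
    where
    respects : ∀ {a a' b b'} → a ≈ a' → b ≈ b' → reesRel a b → reesRel a' b'
    respects a≈a' b≈b' (inj₁ (ma , mb)) = inj₁ (M-resp a≈a' ma , M-resp b≈b' mb)
    respects a≈a' b≈b' (inj₂ a≈b)       = inj₂ (≈-trans (≈-sym a≈a') (≈-trans a≈b b≈b'))

    ·-compatible : ∀ {a a' b b'} → reesRel a a' → reesRel b b' → reesRel (a · b) (a' · b')
    ·-compatible {a} {a'} {b} {b'} (inj₁ (ma , ma')) _ =
      inj₁ (·-absorbˡ a b ma , ·-absorbˡ a' b' ma')
    ·-compatible {a} {a'} {b} {b'} (inj₂ _) (inj₁ (mb , mb')) =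
      inj₁ (·-absorbʳ a b mb , ·-absorbʳ a' b' mb')
    ·-compatible (inj₂ a≈a') (inj₂ b≈b') = inj₂ (·-compat a≈a' b≈b')

    m-compatible : ∀ {a a' b b' c c'} → reesRel a a' → reesRel b b' → reesRel c c' →
                   reesRel (m a b c) (m a' b' c')
    m-compatible {a} {a'} {b} {b'} {c} {c'} (inj₁ (ma , ma')) _ _ =
      inj₁ (m-absorb₁ a b c ma , m-absorb₁ a' b' c' ma')
    m-compatible {a} {a'} {b} {b'} {c} {c'} (inj₂ _) (inj₁ (mb , mb')) _ =
      inj₁ (m-absorb₂ a b c mb , m-absorb₂ a' b' c' mb')
    m-compatible {a} {a'} {b} {b'} {c} {c'} (inj₂ _) (inj₂ _) (inj₁ (mc , mc')) =
      inj₁ (m-absorb₃ a b c mc , m-absorb₃ a' b' c' mc')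
    m-compatible (inj₂ a≈a') (inj₂ b≈b') (inj₂ c≈c') = inj₂ (m-compat a≈a' b≈b' c≈c')

≡-isCongruence : (𝔸 : Alg) → IsCongruence 𝔸 _≡_ _≡_
≡-isCongruence 𝔸 = record
  { isEquivalence = ≡.isEquivalence
  ; respects-≈    = λ { refl refl e → e }
  ; ·-compat      = cong₂ (Alg._·_ 𝔸)
  ; m-compat      = λ { refl refl refl → refl }
  }

module MaxBlock (𝔸 : SBM) where
  open SBM 𝔸
  open IsCongruence σ-cong using (·-compat)
  σ-setoid : Setoid _ _
  σ-setoid = record { isEquivalence = IsCongruence.isEquivalence σ-cong }
  open Setoid σ-setoid using () renaming (refl to σ-refl; sym to σ-sym)
  open import Relation.Binary.Reasoning.Setoid σ-setoid

  InMax-respects-σ : InMax Respects σ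
  InMax-respects-σ {x} {y} x∼y x∈max c = begin
    y · c  ≈⟨ ·-compat (σ-sym x∼y) σ-refl ⟩
    x · c  ≈⟨ x∈max c ⟩
    x      ≈⟨ x∼y ⟩
    y      ∎

  InMax-·ˡ : ∀ a b → InMax a → InMax (a · b)
  InMax-·ˡ a b a∈max = InMax-respects-σ (σ-sym (a∈max b)) a∈max

  InMax-·ʳ : ∀ a b → InMax b → InMax (a · b)
  InMax-·ʳ a b b∈max = InMax-respects-σ (σ-comm b a) (InMax-·ˡ b a b∈max)

  InMax-m : ∀ a b c → InMax ((a · b) · c) → InMax (m a b c)
  InMax-m a b c = InMax-respects-σ (σ-sym (m-σ a b c))

  InMax-isAbsorbing : IsAbsorbing alg InMax
  InMax-isAbsorbing = record
    { ·-absorbˡ = InMax-·ˡ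
    ; ·-absorbʳ = InMax-·ʳ
    ; m-absorb₁ = λ a b c a∈max → InMax-m a b c (InMax-·ˡ _ c (InMax-·ˡ a b a∈max))
    ; m-absorb₂ = λ a b c b∈max → InMax-m a b c (InMax-·ˡ _ c (InMax-·ʳ a b b∈max))
    ; m-absorb₃ = λ a b c c∈max → InMax-m a b c (InMax-·ʳ (a · b) c c∈max)
    }

θ-isCongruence : (𝔸 : SBM) → IsCong (SBM.alg 𝔸) (SBM.θ 𝔸)
θ-isCongruence 𝔸 = Rees.reesRel-isCongruence (SBM.alg 𝔸) (≡-isCongruence (SBM.alg 𝔸))
                     (MaxBlock.InMax-isAbsorbing 𝔸) (≡.subst (SBM.InMax 𝔸))

module SubdirectMax {n : ℕ} (𝔸 : Fin n → SBM) (R : Π 𝔸 → Set) (S : IsSubdirect 𝔸 R) where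
  open Alg (subAlg 𝔸 R S)
  private
    _≈_ : Rel Carrier 0ℓ
    _≈_ = _≈R_ 𝔸
    module Coord (i : Fin n) = IsCongruence (≡-isCongruence (SBM.alg (𝔸 i)))

  ≈R-isCongruence : IsCongruence (subAlg 𝔸 R S) _≈_ _≈_
  ≈R-isCongruence = record
    { isEquivalence = record
      { refl  = λ i → refl
      ; sym   = λ x≈y i → ≡.sym (x≈y i)
      ; trans = λ x≈y y≈z i → ≡.trans (x≈y i) (y≈z i)
      }
    ; respects-≈ = λ a≈a' b≈b' a≈b i → ≡.trans (≡.sym (a≈a' i)) (≡.trans (a≈b i) (b≈b' i))
    ; ·-compat   = λ a≈a' b≈b' i → Coord.·-compat i (a≈a' i) (b≈b' i)
    ; m-compat   = λ a≈a' b≈b' c≈c' i → Coord.m-compat i (a≈a' i) (b≈b' i) (c≈c' i)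
    }

  InMaxR-respects-≈R : InMaxR 𝔸 Respects _≈_
  InMaxR-respects-≈R x≈y x∈max i = ≡.subst (SBM.InMax (𝔸 i)) (x≈y i) (x∈max i)

  InMaxR-isAbsorbing : IsAbsorbing (subAlg 𝔸 R S) (InMaxR 𝔸)
  InMaxR-isAbsorbing = record
    { ·-absorbˡ = λ a b a∈max i → Max.·-absorbˡ i (proj₁ a i) (proj₁ b i) (a∈max i)
    ; ·-absorbʳ = λ a b b∈max i → Max.·-absorbʳ i (proj₁ a i) (proj₁ b i) (b∈max i)
    ; m-absorb₁ = λ a b c a∈max i → Max.m-absorb₁ i (proj₁ a i) (proj₁ b i) (proj₁ c i) (a∈max i)
    ; m-absorb₂ = λ a b c b∈max i → Max.m-absorb₂ i (proj₁ a i) (proj₁ b i) (proj₁ c i) (b∈max i)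
    ; m-absorb₃ = λ a b c c∈max i → Max.m-absorb₃ i (proj₁ a i) (proj₁ b i) (proj₁ c i) (c∈max i)
    }
    where
    module Max (i : Fin n) = IsAbsorbing (MaxBlock.InMax-isAbsorbing (𝔸 i))

θR-isCongruence : (n : ℕ) (𝔸 : Fin n → SBM) (R : Π 𝔸 → Set) (S : IsSubdirect 𝔸 R) →
                  IsCongruence (subAlg 𝔸 R S) (_≈R_ 𝔸) (θR 𝔸)
-- The elements x y must be bound explicitly: _≈R_ and InMaxR only mention proj₁,
-- so Agda cannot infer the membership proofs in R from them.
θR-isCongruence n 𝔸 R S = Rees.reesRel-isCongruence (subAlg 𝔸 R S) ≈R-isCongruence
                            InMaxR-isAbsorbing (λ {x} {y} → InMaxR-respects-≈R {x} {y})
  where open SubdirectMax 𝔸 R S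

lemma9 : ((𝔸 : SBM) → IsCong (SBM.alg 𝔸) (SBM.θ 𝔸))
    × ((n : ℕ) (𝔸 : Fin n → SBM) (R : Π 𝔸 → Set) (S : IsSubdirect 𝔸 R) →
    IsCongruence (subAlg 𝔸 R S) (_≈R_ 𝔸) (θR 𝔸))
lemma9 = θ-isCongruence , θR-isCongruence
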